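{- For every integer $n\ge 3$, the number of Dyck $n$-paths that end with $DD$ and contain an occurrence of $DUU$ at ground level is $C^{(4)}_{n-3}$, where $C^{(j)}_{m}=\frac{j}{2m+j}\binom{2m+j}{m}$.
   Context: Dyck paths are words in $U$ (upstep) and $D$ (downstep) with equally many of each such that every prefix has at least as many $U$'s as $D$'s; a Dyck $n$-path has $n$ upsteps. An occurrence of $DUU$ (three consecutive steps $D,U,U$) is at ground level if its $D$ ends at height $0$. -}

module Defs where

open import Data.Nat using (ℕ; zero; suc; _+_; _*_; _∸_; _/_; _≤_; _≤?_; _≟_)
open import Data.Nat.Combinatorics using (_C_)
open import Data.List using (List; []; _∷_; _++_; length; map; concatMap; filter)
open import Data.List.Relation.Unary.All using (All)
open import Data.Product using (_×_; ∃; ∃-syntax; _,_)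
open import Relation.Binary.PropositionalEquality using (_≡_)
open import Relation.Nullary using (Dec; yes; no; ¬_)

data Step : Set where
  U D : Step

#U #D : List Step → ℕ
#U []      = 0
#U (U ∷ w) = suc (#U w)
#U (D ∷ w) = #U w
#D []      = 0
#D (U ∷ w) = #D w
#D (D ∷ w) = suc (#D w)

prefixes : List Step → List (List Step)
prefixes []      = [] ∷ []
prefixes (s ∷ w) = [] ∷ map (s ∷_) (prefixes w)

record DyckPath (n : ℕ) (w : List Step) : Set where
  constructor dyck
  field
    ups     : #U w ≡ n
    downs   : #D w ≡ n
    prefix≥ : All (λ p → #D p ≤ #U p) (prefixes w)

EndsWithDD : List Step → Set
EndsWithDD w = ∃[ v ] w ≡ v ++ (D ∷ D ∷ [])

-- w has an occurrence of DUU whose D ends at height 0: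
-- w = p ++ D ∷ U ∷ U ∷ s with the prefix p ++ [D] at height 0,
-- i.e. #U (p ++ [D]) = #D (p ++ [D]).
GroundDUU : List Step → Set
GroundDUU w = ∃[ p ] ∃[ s ] (w ≡ p ++ (D ∷ U ∷ U ∷ s))
                          × (#U (p ++ (D ∷ [])) ≡ #D (p ++ (D ∷ [])))

Counted : ℕ → List Step → Set
Counted n w = DyckPath n w × EndsWithDD w × GroundDUU w

-- Generalized Catalan (ballot) number C^{(j)}_m = j/(2m+j) * binom(2m+j, m), for j ≥ 1
-- (the division is exact; 2m+j = suc (2m + (j-1)) is nonzero).
genCatalan : (j m : ℕ) → ℕ
genCatalan zero    m = 0
genCatalan (suc j) m = (suc j * ((2 * m + suc j) C m)) / suc (2 * m + j)

-- A Dyck path with a DUU at ground level returns to ground before its end, so it is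
-- U u D R with u a Dyck path and R a nonempty Dyck path; if it ends with D D, then
-- R = v D D for a nonnegative walk v from height 0 to height 2.  Conversely the last visit
-- of such a v to height 0 is followed by U U, which gives a DUU at ground level.  Sending
-- U u D v D D to u D v̄, where v̄ is v reversed with U and D exchanged, is a bijection onto
-- the nonnegative walks from height 3 to 0 with n ∸ 3 up-steps.  By the reflection
-- principle the nonnegative walks from height h to 0 with k up-steps number
-- C(h + 2k, k) − C(h + 2k, h + k + 1) = C^{(h+1)}_k.
module Submission where

open import Defs
open import Data.Nat using (ℕ; zero; suc; _+_; _*_; _∸_; _≤_; _/_; z≤n; s≤s)
open import Data.Nat.Properties
open import Data.Nat.Combinatorics
  using (_C_; nCk+nC[k+1]≡[n+1]C[k+1]; nCk≡nC[n∸k]; k>n⇒nCk≡0; nC1≡n)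
open import Data.Nat.DivMod using (m*n/n≡m)
open import Data.Nat.Tactic.RingSolver using (solve-∀)
open import Data.List using (List; []; _∷_; _++_; length; map; drop)
open import Data.List.Properties
  using (++-assoc; ++-identityʳ; ++-conicalʳ; ∷-injectiveʳ; length-map; length-++;
         map-∘; map-id-local)
open import Data.List.Relation.Unary.All as All using (All; []; _∷_)
import Data.List.Relation.Unary.All.Properties as All
open import Data.List.Relation.Unary.Any using (here)
open import Data.List.Relation.Unary.AllPairs using ([]; _∷_)
open import Data.List.Relation.Unary.Unique.Propositional using (Unique)
import Data.List.Relation.Unary.Unique.Propositional.Properties as Unique
open import Data.List.Membership.Propositional using (_∈_)
open import Data.List.Membership.Propositional.Properties
  using (∈-map⁺; ∈-map⁻; ∈-++⁺ˡ; ∈-++⁺ʳ; ∈-++⁻)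
open import Data.Product using (_×_; ∃-syntax; _,_; proj₁; map₁; uncurry)
open import Data.Sum using (_⊎_; inj₁; inj₂)
open import Function using (_∘_)
open import Function.Bundles using (_⇔_; mk⇔)
open import Relation.Binary.PropositionalEquality
open import Relation.Nullary using (¬_)

private
  variable
    n x y z : ℕ
    u v w : List Step

unique-map-with-retraction : ∀ {A B : Set} {f : A → B} {g : B → A} {xs} →
                             All (λ x → g (f x) ≡ x) xs → Unique xs → Unique (map f xs)
unique-map-with-retraction {g = g} {xs = xs} retraction unique =
  Unique.map⁻ {f = g} (subst Unique (sym (trans (sym (map-∘ xs)) (map-id-local retraction))) unique)

DD-suffix : ∀ A e {s₁ s₂ r} → A ++ s₁ ∷ s₂ ∷ r ≡ e ++ D ∷ D ∷ [] →
            ∃[ e′ ] s₁ ∷ s₂ ∷ r ≡ e′ ++ D ∷ D ∷ []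
DD-suffix []          e       eq = e , eq
DD-suffix (_ ∷ A)     (_ ∷ e) eq = DD-suffix A e (∷-injectiveʳ eq)
DD-suffix (_ ∷ [])    []      ()
DD-suffix (_ ∷ _ ∷ A) []      eq with ++-conicalʳ A _ (∷-injectiveʳ (∷-injectiveʳ eq))
... | ()

data Walk : ℕ → ℕ → List Step → Set where
  nil  : Walk x x []
  up   : Walk (suc x) y w → Walk x y (U ∷ w)
  down : Walk x y w → Walk (suc x) y (D ∷ w)

#U-++ : ∀ u v → #U (u ++ v) ≡ #U u + #U v
#U-++ []      v = refl
#U-++ (U ∷ u) v = cong suc (#U-++ u v)
#U-++ (D ∷ u) v = #U-++ u v

walk-balance : Walk x y w → #U w + x ≡ #D w + y
walk-balance nil                      = refl
walk-balance {x} (up {w = w} p)       = trans (sym (+-suc (#U w) x)) (walk-balance p)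
walk-balance (down {x = x} {w = w} p) = trans (+-suc (#U w) x) (cong suc (walk-balance p))

walk-balanced : Walk x x w → #U w ≡ #D w
walk-balanced {x} p = +-cancelʳ-≡ x _ _ (walk-balance p)

walk-lift : Walk x y w → Walk (suc x) (suc y) w
walk-lift nil      = nil
walk-lift (up p)   = up (walk-lift p)
walk-lift (down p) = down (walk-lift p)

walk-++ : Walk x y u → Walk y z v → Walk x z (u ++ v)
walk-++ nil      q = q
walk-++ (up p)   q = up (walk-++ p q)
walk-++ (down p) q = down (walk-++ p q)

walk-++⁻ : ∀ u → Walk x z (u ++ v) → ∃[ y ] Walk x y u × Walk y z v
walk-++⁻ []      p        = _ , nil , p
walk-++⁻ (U ∷ u) (up p)   with walk-++⁻ u p
... | y , q , r = y , up q , r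
walk-++⁻ (D ∷ u) (down p) with walk-++⁻ u p
... | y , q , r = y , down q , r

walk-++⁻-balanced : ∀ u → Walk 0 z (u ++ v) → #U u ≡ #D u → Walk 0 0 u × Walk 0 z v
walk-++⁻-balanced u p balanced with walk-++⁻ u p
... | y , q , r with +-cancelˡ-≡ (#D u) 0 y (trans (cong (_+ 0) (sym balanced)) (walk-balance q))
... | refl = q , r

walk-DD⁻ : ∀ v → Walk x 0 (v ++ D ∷ D ∷ []) → Walk x 2 v
walk-DD⁻ v p with walk-++⁻ v p
... | _ , q , down (down nil) = q

-- The heights of u are measured from level h + 1, which w leaves for the first time by
-- the displayed D.
walk-first-passage : ∀ j {h w} → Walk (j + suc h) 0 w →
                     ∃[ u ] ∃[ v ] Walk j 0 u × Walk h 0 v × w ≡ u ++ D ∷ v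
walk-first-passage j {h} p = go j p refl
  where
  go : ∀ i {x w} → Walk x 0 w → x ≡ i + suc h →
       ∃[ u ] ∃[ v ] Walk i 0 u × Walk h 0 v × w ≡ u ++ D ∷ v
  go zero    nil      ()
  go (suc i) nil      ()
  go i       (up p)   eq with go (suc i) p (cong suc eq)
  ... | u , v , q , r , refl = U ∷ u , v , up q , r , refl
  go zero    (down p) refl = [] , _ , nil , p , refl
  go (suc i) (down p) refl with go i p refl
  ... | u , v , q , r , refl = D ∷ u , v , down q , r , refl

first-return : Walk 0 0 w →
               w ≡ [] ⊎ ∃[ u ] ∃[ v ] Walk 0 0 u × Walk 0 0 v × w ≡ U ∷ u ++ D ∷ v
first-return nil    = inj₁ refl
first-return (up p) with walk-first-passage 0 p
... | u , v , q , r , refl = inj₂ (u , v , q , r , refl)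

firstPassage : ℕ → List Step → List Step × List Step
firstPassage x       []      = [] , []
firstPassage x       (U ∷ w) = map₁ (U ∷_) (firstPassage (suc x) w)
firstPassage zero    (D ∷ w) = [] , w
firstPassage (suc x) (D ∷ w) = map₁ (D ∷_) (firstPassage x w)

firstPassage-++ : Walk x y u → firstPassage x (u ++ v) ≡ map₁ (u ++_) (firstPassage y v)
firstPassage-++ nil      = refl
firstPassage-++ (up p)   = cong (map₁ (U ∷_)) (firstPassage-++ p)
firstPassage-++ (down p) = cong (map₁ (D ∷_)) (firstPassage-++ p)

firstPassage-dyck : Walk 0 0 u → firstPassage 0 (u ++ D ∷ v) ≡ (u , v)
firstPassage-dyck {u} p = trans (firstPassage-++ p) (cong (_, _) (++-identityʳ u))

opposite : Step → Step
opposite U = D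
opposite D = U

mirror : List Step → List Step
mirror []      = []
mirror (s ∷ w) = mirror w ++ opposite s ∷ []

mirror-++ : ∀ u v → mirror (u ++ v) ≡ mirror v ++ mirror u
mirror-++ []      v = sym (++-identityʳ (mirror v))
mirror-++ (s ∷ u) v =
  trans (cong (_++ opposite s ∷ []) (mirror-++ u v)) (++-assoc (mirror v) (mirror u) _)

mirror-involutive : ∀ w → mirror (mirror w) ≡ w
mirror-involutive []      = refl
mirror-involutive (U ∷ w) =
  trans (mirror-++ (mirror w) (D ∷ [])) (cong (U ∷_) (mirror-involutive w))
mirror-involutive (D ∷ w) =
  trans (mirror-++ (mirror w) (U ∷ [])) (cong (D ∷_) (mirror-involutive w))

walk-mirror : Walk x y w → Walk y x (mirror w)
walk-mirror nil      = nil
walk-mirror (up p)   = walk-++ (walk-mirror p) (down nil)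
walk-mirror (down p) = walk-++ (walk-mirror p) (up nil)

#U-mirror : ∀ w → #U (mirror w) ≡ #D w
#U-mirror []      = refl
#U-mirror (U ∷ w) = trans (#U-++ (mirror w) (D ∷ [])) (trans (+-identityʳ _) (#U-mirror w))
#U-mirror (D ∷ w) = trans (#U-++ (mirror w) (U ∷ [])) (trans (+-comm _ 1) (cong suc (#U-mirror w)))

walk-ends-with-D : Walk x 0 w → w ≡ [] ⊎ ∃[ u ] w ≡ u ++ D ∷ []
walk-ends-with-D {w = w} p with mirror w | walk-mirror p | mirror-involutive w
... | []    | _ | eq = inj₁ (sym eq)
... | U ∷ u | _ | eq = inj₂ (mirror u , sym eq)

last-ground-visit : Walk 0 2 w → ∃[ u ] ∃[ v ] Walk 0 0 u × w ≡ u ++ U ∷ U ∷ v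
last-ground-visit {w} p with walk-first-passage 1 (walk-mirror p)
... | u , v , q , r , eq with walk-ends-with-D q
... | inj₁ refl with () ← q
... | inj₂ (u′ , refl) = mirror v , mirror u′ , walk-mirror r , (begin
  w                                              ≡⟨ mirror-involutive w ⟨
  mirror (mirror w)                              ≡⟨ cong mirror eq ⟩
  mirror ((u′ ++ D ∷ []) ++ D ∷ v)               ≡⟨ mirror-++ (u′ ++ D ∷ []) (D ∷ v) ⟩
  (mirror v ++ U ∷ []) ++ mirror (u′ ++ D ∷ [])  ≡⟨ cong (_ ++_) (mirror-++ u′ (D ∷ [])) ⟩
  (mirror v ++ U ∷ []) ++ U ∷ mirror u′          ≡⟨ ++-assoc (mirror v) (U ∷ []) _ ⟩
  mirror v ++ U ∷ U ∷ mirror u′                  ∎)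
  where open ≡-Reasoning

walk⇒bounded-prefixes : Walk x y w → All (λ q → #D q ≤ #U q + x) (prefixes w)
walk⇒bounded-prefixes nil              = z≤n ∷ []
walk⇒bounded-prefixes {x} (up p)       =
  z≤n ∷ All.map⁺ (All.map (λ {q} → subst (#D q ≤_) (+-suc (#U q) x))
                          (walk⇒bounded-prefixes p))
walk⇒bounded-prefixes (down {x = x} p) =
  z≤n ∷ All.map⁺ (All.map (λ {q} → subst (suc (#D q) ≤_) (sym (+-suc (#U q) x)) ∘ s≤s)
                          (walk⇒bounded-prefixes p))

bounded-prefixes⇒walk : ∀ w → All (λ q → #D q ≤ #U q + x) (prefixes w) →
                        #U w + x ≡ #D w + y → Walk x y w
bounded-prefixes⇒walk           []          _              refl = nil
bounded-prefixes⇒walk {x}       (U ∷ w)     (_ ∷ bounded)  eq   =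
  up (bounded-prefixes⇒walk w (All.map (λ {q} → subst (#D q ≤_) (sym (+-suc (#U q) x)))
                                       (All.map⁻ bounded))
                              (trans (+-suc (#U w) x) eq))
bounded-prefixes⇒walk {zero}    (D ∷ [])    (_ ∷ (() ∷ _)) _
bounded-prefixes⇒walk {zero}    (D ∷ _ ∷ _) (_ ∷ (() ∷ _)) _
bounded-prefixes⇒walk {suc x}   (D ∷ w)     (_ ∷ bounded)  eq   =
  down (bounded-prefixes⇒walk w
          (All.map (λ {q} → ≤-pred ∘ subst (suc (#D q) ≤_) (+-suc (#U q) x)) (All.map⁻ bounded))
                                (suc-injective (trans (sym (+-suc (#U w) x)) eq)))

dyck⇒walk : DyckPath n w → Walk 0 0 w
dyck⇒walk {w = w} (dyck ups downs bounded) =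
  bounded-prefixes⇒walk w (All.map (λ {q} → subst (#D q ≤_) (sym (+-identityʳ (#U q)))) bounded)
                          (cong (_+ 0) (trans ups (sym downs)))

walk⇒dyck : Walk 0 0 w → #U w ≡ n → DyckPath n w
walk⇒dyck p ups =
  dyck ups
       (trans (sym (+-identityʳ _)) (trans (sym (walk-balance p)) (trans (+-identityʳ _) ups)))
       (All.map (λ {q} → subst (#D q ≤_) (+-identityʳ (#U q))) (walk⇒bounded-prefixes p))

walks : ℕ → ℕ → List (List Step)
walks zero    zero    = [] ∷ []
walks (suc h) zero    = map (D ∷_) (walks h zero)
walks zero    (suc k) = map (U ∷_) (walks 1 k)
walks (suc h) (suc k) = map (U ∷_) (walks (suc (suc h)) k) ++ map (D ∷_) (walks h (suc k))

∈-walks⁻ : ∀ h k → w ∈ walks h k → Walk h 0 w × #U w ≡ k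
∈-walks⁻ zero    zero    (here refl) = nil , refl
∈-walks⁻ (suc h) zero    w∈ with ∈-map⁻ (D ∷_) w∈
... | _ , w∈′ , refl with ∈-walks⁻ h zero w∈′
... | p , ups = down p , ups
∈-walks⁻ zero    (suc k) w∈ with ∈-map⁻ (U ∷_) w∈
... | _ , w∈′ , refl with ∈-walks⁻ 1 k w∈′
... | p , ups = up p , cong suc ups
∈-walks⁻ (suc h) (suc k) w∈ with ∈-++⁻ (map (U ∷_) (walks (suc (suc h)) k)) w∈
... | inj₁ w∈U with ∈-map⁻ (U ∷_) w∈U
...   | _ , w∈′ , refl with ∈-walks⁻ (suc (suc h)) k w∈′
...     | p , ups = up p , cong suc ups
∈-walks⁻ (suc h) (suc k) w∈ | inj₂ w∈D with ∈-map⁻ (D ∷_) w∈D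
...   | _ , w∈′ , refl with ∈-walks⁻ h (suc k) w∈′
...     | p , ups = down p , ups

∈-walks⁺ : ∀ {h k} → Walk h 0 w → #U w ≡ k → w ∈ walks h k
∈-walks⁺ {h = zero}  {zero}  nil      _   = here refl
∈-walks⁺ {h = suc h} {zero}  (down p) ups = ∈-map⁺ (D ∷_) (∈-walks⁺ p ups)
∈-walks⁺ {h = zero}  {suc k} (up p)   ups = ∈-map⁺ (U ∷_) (∈-walks⁺ p (suc-injective ups))
∈-walks⁺ {h = suc h} {suc k} (up p)   ups =
  ∈-++⁺ˡ (∈-map⁺ (U ∷_) (∈-walks⁺ p (suc-injective ups)))
∈-walks⁺ {h = suc h} {suc k} (down p) ups =
  ∈-++⁺ʳ (map (U ∷_) (walks (suc (suc h)) k)) (∈-map⁺ (D ∷_) (∈-walks⁺ p ups))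

walks-unique : ∀ h k → Unique (walks h k)
walks-unique zero    zero    = [] ∷ []
walks-unique (suc h) zero    = Unique.map⁺ ∷-injectiveʳ (walks-unique h zero)
walks-unique zero    (suc k) = Unique.map⁺ ∷-injectiveʳ (walks-unique 1 k)
walks-unique (suc h) (suc k) =
  Unique.++⁺ (Unique.map⁺ ∷-injectiveʳ (walks-unique (suc (suc h)) k))
             (Unique.map⁺ ∷-injectiveʳ (walks-unique h (suc k)))
             disjoint
  where
  disjoint : ¬ (w ∈ map (U ∷_) (walks (suc (suc h)) k) × w ∈ map (D ∷_) (walks h (suc k)))
  disjoint (w∈U , w∈D) with ∈-map⁻ (U ∷_) w∈U | ∈-map⁻ (D ∷_) w∈D
  ... | _ , _ , refl | _ , _ , ()

length-walks-zero : ∀ h → length (walks h 0) ≡ 1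
length-walks-zero zero    = refl
length-walks-zero (suc h) = trans (length-map (D ∷_) (walks h 0)) (length-walks-zero h)

length-walks-suc : ∀ h k →
  length (walks (suc h) (suc k)) ≡ length (walks (suc (suc h)) k) + length (walks h (suc k))
length-walks-suc h k =
  trans (length-++ (map (U ∷_) (walks (suc (suc h)) k)))
        (cong₂ _+_ (length-map (U ∷_) (walks (suc (suc h)) k))
                   (length-map (D ∷_) (walks h (suc k))))

pascal : ∀ n k → suc n C suc k ≡ n C k + n C suc k
pascal n k = sym (nCk+nC[k+1]≡[n+1]C[k+1] n k)

pascal-reflection : ∀ n i j {x y} → x + n C suc i ≡ n C j → y + n C i ≡ n C suc j →
                    (x + y) + suc n C suc i ≡ suc n C suc j
pascal-reflection n i j {x} {y} eqˣ eqʸ = begin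
  (x + y) + suc n C suc i        ≡⟨ cong ((x + y) +_) (pascal n i) ⟩
  (x + y) + (n C i + n C suc i)  ≡⟨ interchange x y (n C i) (n C suc i) ⟩
  (x + n C suc i) + (y + n C i)  ≡⟨ cong₂ _+_ eqˣ eqʸ ⟩
  n C j + n C suc j              ≡⟨ pascal n j ⟨
  suc n C suc j                  ∎
  where
  open ≡-Reasoning
  interchange : ∀ a b c d → (a + b) + (c + d) ≡ (a + d) + (b + c)
  interchange = solve-∀

-- Such walks have k + (h + k) steps; by the reflection principle the second summand counts
-- the step sequences from h to 0 with k up-steps that do go below height 0.
length-walks-reflection : ∀ h k →
  length (walks h k) + (k + (h + k)) C suc (h + k) ≡ (k + (h + k)) C k
length-walks-reflection h       zero    =
  cong₂ _+_ (length-walks-zero h) (k>n⇒nCk≡0 (n<1+n (h + 0)))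
length-walks-reflection zero    (suc k) =
  trans (cong (_+ suc N C suc (suc k))
              (trans (length-map (U ∷_) (walks 1 k)) (sym (+-identityʳ _))))
        (pascal-reflection N (suc k) k (length-walks-reflection 1 k) refl)
  where
  N : ℕ
  N = k + suc k
length-walks-reflection (suc h) (suc k) =
  trans (cong (_+ suc N C suc (suc (h + suc k))) (length-walks-suc h k))
        (pascal-reflection N (suc (h + suc k)) k
          (subst (λ d → length (walks (suc (suc h)) k) + (k + suc d) C suc (suc d)
                        ≡ (k + suc d) C k)
                 (sym (+-suc h k)) (length-walks-reflection (suc (suc h)) k))
          (subst (λ m → length (walks h (suc k)) + m C suc (h + suc k) ≡ m C suc k)
                 (sym (+-suc k (h + suc k))) (length-walks-reflection h (suc k))))
  where
  N : ℕ
  N = k + suc (h + suc k)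

absorption : ∀ n k → suc k * (suc n C suc k) ≡ suc n * (n C k)
absorption n       zero    =
  trans (+-identityʳ _) (trans (nC1≡n (suc n)) (sym (*-identityʳ (suc n))))
absorption zero    (suc k) = *-zeroʳ (suc (suc k))
absorption (suc n) (suc k) = begin
  suc (suc k) * (suc (suc n) C suc (suc k))
    ≡⟨ cong (suc (suc k) *_) (pascal (suc n) (suc k)) ⟩
  suc (suc k) * (suc n C suc k + suc n C suc (suc k))
    ≡⟨ expand (suc k) (suc n C suc k) (suc n C suc (suc k)) ⟩
  (suc n C suc k + suc k * (suc n C suc k)) + suc (suc k) * (suc n C suc (suc k))
    ≡⟨ cong₂ (λ a b → (suc n C suc k + a) + b) (absorption n k) (absorption n (suc k)) ⟩
  (suc n C suc k + suc n * (n C k)) + suc n * (n C suc k)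
    ≡⟨ collect (suc n C suc k) (suc n) (n C k) (n C suc k) ⟩
  suc n C suc k + suc n * (n C k + n C suc k)
    ≡⟨ cong (λ c → suc n C suc k + suc n * c) (pascal n k) ⟨
  suc (suc n) * (suc n C suc k)
    ∎
  where
  open ≡-Reasoning
  expand : ∀ m a b → suc m * (a + b) ≡ (a + m * a) + suc m * b
  expand = solve-∀
  collect : ∀ c m a b → (c + m * a) + m * b ≡ c + m * (a + b)
  collect = solve-∀

length-walks-ballot : ∀ h k →
  suc h * ((2 * k + suc h) C k) ≡ length (walks h k) * suc (2 * k + h)
length-walks-ballot h zero    =
  trans (*-identityʳ (suc h))
        (sym (trans (cong (_* suc h) (length-walks-zero h)) (*-identityˡ (suc h))))
length-walks-ballot h (suc j) = begin
  suc h * ((2 * suc j + suc h) C suc j)  ≡⟨ cong (λ m → suc h * (m C suc j)) (size h j) ⟩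
  suc h * B                              ≡⟨ +-cancelʳ-≡ (2 * (suc j * B)) _ _ doubled ⟩
  L * suc N                              ≡⟨ cong (λ m → L * suc m) (size′ h j) ⟩
  L * suc (2 * suc j + h)                ∎
  where
  open ≡-Reasoning
  L N B : ℕ
  L = length (walks h (suc j))
  N = suc j + (h + suc j)
  B = suc N C suc j
  size : ∀ h j → 2 * suc j + suc h ≡ suc (suc j + (h + suc j))
  size = solve-∀
  size′ : ∀ h j → suc j + (h + suc j) ≡ 2 * suc j + h
  size′ = solve-∀
  reflected : L + N C j ≡ N C suc j
  reflected = subst (λ c → L + c ≡ N C suc j)
                    (trans (nCk≡nC[n∸k] (s≤s (m≤n+m (h + suc j) j)))
                           (cong (N C_) (m+n∸n≡m j (h + suc j))))
                    (length-walks-reflection h (suc j))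
  regroup : ∀ h j b → suc h * b + 2 * (suc j * b) ≡ suc (suc j + (h + suc j)) * b
  regroup = solve-∀
  cancel : ∀ a m l → a + (m * l + a) ≡ l * m + 2 * a
  cancel = solve-∀
  doubled : suc h * B + 2 * (suc j * B) ≡ L * suc N + 2 * (suc j * B)
  doubled = begin
    suc h * B + 2 * (suc j * B)                ≡⟨ regroup h j B ⟩
    suc N * B                                  ≡⟨ cong (suc N *_) (pascal N j) ⟩
    suc N * (N C j + N C suc j)                ≡⟨ *-distribˡ-+ (suc N) (N C j) (N C suc j) ⟩
    suc N * (N C j) + suc N * (N C suc j)
      ≡⟨ cong₂ _+_ (absorption N j) (cong (suc N *_) reflected) ⟨
    suc j * B + suc N * (L + N C j)
      ≡⟨ cong (suc j * B +_) (*-distribˡ-+ (suc N) L (N C j)) ⟩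
    suc j * B + (suc N * L + suc N * (N C j))
      ≡⟨ cong (λ c → suc j * B + (suc N * L + c)) (absorption N j) ⟨
    suc j * B + (suc N * L + suc j * B)
      ≡⟨ cancel (suc j * B) (suc N) L ⟩
    L * suc N + 2 * (suc j * B)
      ∎

length-walks : ∀ h k → length (walks h k) ≡ genCatalan (suc h) k
length-walks h k =
  sym (trans (cong (_/ suc (2 * k + h)) (length-walks-ballot h k))
             (m*n/n≡m (length (walks h k)) (suc (2 * k + h))))

assemble : List Step → List Step → List Step
assemble u v = U ∷ u ++ D ∷ v ++ D ∷ D ∷ []

fromBallot : List Step → List Step
fromBallot = uncurry (λ u v → assemble u (mirror v)) ∘ firstPassage 0

toBallot : List Step → List Step
toBallot []      = []
toBallot (_ ∷ w) = uncurry (λ u v → u ++ D ∷ drop 2 (mirror v)) (firstPassage 0 w)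

fromBallot-++ : Walk 0 0 u → fromBallot (u ++ D ∷ v) ≡ assemble u (mirror v)
fromBallot-++ p = cong (uncurry (λ u v → assemble u (mirror v))) (firstPassage-dyck p)

toBallot-assemble : Walk 0 0 u → toBallot (assemble u v) ≡ u ++ D ∷ mirror v
toBallot-assemble {u} {v} p = begin
  toBallot (assemble u v)
    ≡⟨ cong (uncurry (λ u v → u ++ D ∷ drop 2 (mirror v))) (firstPassage-dyck p) ⟩
  u ++ D ∷ drop 2 (mirror (v ++ D ∷ D ∷ []))
    ≡⟨ cong (λ t → u ++ D ∷ drop 2 t) (mirror-++ v (D ∷ D ∷ [])) ⟩
  u ++ D ∷ mirror v
    ∎
  where open ≡-Reasoning

toBallot-fromBallot : Walk 3 0 w → toBallot (fromBallot w) ≡ w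
toBallot-fromBallot p with walk-first-passage 0 p
... | u , v , q , _ , refl =
  trans (cong toBallot (fromBallot-++ q))
        (trans (toBallot-assemble q) (cong (λ t → u ++ D ∷ t) (mirror-involutive v)))

#U-fromBallot : Walk 3 0 w → #U (fromBallot w) ≡ 3 + #U w
#U-fromBallot p with walk-first-passage 0 p
... | u , v , q , r , refl = begin
  #U (fromBallot (u ++ D ∷ v))                 ≡⟨ cong #U (fromBallot-++ q) ⟩
  suc (#U (u ++ D ∷ mirror v ++ D ∷ D ∷ []))   ≡⟨ cong suc (#U-++ u _) ⟩
  suc (#U u + #U (mirror v ++ D ∷ D ∷ []))
    ≡⟨ cong (λ c → suc (#U u + c)) (#U-++ (mirror v) (D ∷ D ∷ [])) ⟩
  suc (#U u + (#U (mirror v) + 0))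
    ≡⟨ cong (λ c → suc (#U u + (c + 0))) (#U-mirror v) ⟩
  suc (#U u + (#D v + 0))                      ≡⟨ cong (λ c → suc (#U u + c)) (walk-balance r) ⟨
  suc (#U u + (#U v + 2))                      ≡⟨ shuffle (#U u) (#U v) ⟩
  3 + (#U u + #U v)                            ≡⟨ cong (3 +_) (#U-++ u (D ∷ v)) ⟨
  3 + #U (u ++ D ∷ v)                          ∎
  where
  open ≡-Reasoning
  shuffle : ∀ a b → suc (a + (b + 2)) ≡ 3 + (a + b)
  shuffle = solve-∀

assemble-counted : Walk 0 0 u → Walk 0 2 v → Counted (#U (assemble u v)) (assemble u v)
assemble-counted {u} {v} p q =
  walk⇒dyck (prepend-prime (walk-++ q (down (down nil)))) refl ,
  (U ∷ u ++ D ∷ v , cong (U ∷_) (sym (++-assoc u (D ∷ v) (D ∷ D ∷ [])))) ,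
  ground-DUU
  where
  prepend-prime : Walk 0 0 w → Walk 0 0 (U ∷ u ++ D ∷ w)
  prepend-prime r = up (walk-++ (walk-lift p) (down r))
  ground-DUU : GroundDUU (assemble u v)
  ground-DUU with last-ground-visit q
  ... | t , z , r , refl with walk-ends-with-D (prepend-prime r)
  ... | inj₂ (s , head≡s++D) = s , z ++ D ∷ D ∷ [] , split , balanced
    where
    UUz : List Step
    UUz = U ∷ U ∷ z ++ D ∷ D ∷ []
    split : assemble u (t ++ U ∷ U ∷ z) ≡ s ++ D ∷ UUz
    split = begin
      U ∷ u ++ D ∷ (t ++ U ∷ U ∷ z) ++ D ∷ D ∷ []
        ≡⟨ cong (λ c → U ∷ u ++ D ∷ c) (++-assoc t (U ∷ U ∷ z) _) ⟩
      U ∷ u ++ D ∷ t ++ UUz                        ≡⟨ cong (U ∷_) (++-assoc u (D ∷ t) UUz) ⟨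
      (U ∷ u ++ D ∷ t) ++ UUz                      ≡⟨ cong (_++ UUz) head≡s++D ⟩
      (s ++ D ∷ []) ++ UUz                         ≡⟨ ++-assoc s (D ∷ []) UUz ⟩
      s ++ D ∷ UUz                                 ∎
      where open ≡-Reasoning
    balanced : #U (s ++ D ∷ []) ≡ #D (s ++ D ∷ [])
    balanced = subst (λ c → #U c ≡ #D c) head≡s++D (walk-balanced (prepend-prime r))

fromBallot-counted : Walk 3 0 w → Counted (3 + #U w) (fromBallot w)
fromBallot-counted p with walk-first-passage 0 p
... | u , v , q , r , refl =
  subst (λ n → Counted n (fromBallot (u ++ D ∷ v))) (#U-fromBallot p)
        (subst (λ c → Counted (#U c) c) (sym (fromBallot-++ q))
               (assemble-counted q (walk-mirror r)))

ground-DUU⇒first-return : Walk 0 0 w → GroundDUU w →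
  ∃[ u ] ∃[ t ] ∃[ s ] Walk 0 0 u × Walk 0 0 (t ++ U ∷ U ∷ s)
                     × w ≡ U ∷ u ++ D ∷ t ++ U ∷ U ∷ s
ground-DUU⇒first-return p (q , s , refl , balanced)
  with walk-++⁻-balanced (q ++ D ∷ []) (subst (Walk 0 0) (sym (++-assoc q (D ∷ []) _)) p) balanced
... | head , tail with first-return head
... | inj₁ q++D≡[] with () ← ++-conicalʳ q _ q++D≡[]
... | inj₂ (u , t , r , r′ , eq) = u , t , s , r , walk-++ r′ tail , (begin
  q ++ D ∷ U ∷ U ∷ s               ≡⟨ ++-assoc q (D ∷ []) _ ⟨
  (q ++ D ∷ []) ++ U ∷ U ∷ s       ≡⟨ cong (_++ U ∷ U ∷ s) eq ⟩
  (U ∷ u ++ D ∷ t) ++ U ∷ U ∷ s    ≡⟨ cong (U ∷_) (++-assoc u (D ∷ t) _) ⟩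
  U ∷ u ++ D ∷ t ++ U ∷ U ∷ s      ∎)
  where open ≡-Reasoning

counted⇒assemble : Counted n w → ∃[ u ] ∃[ v ] Walk 0 0 u × Walk 0 2 v × w ≡ assemble u v
counted⇒assemble (dyck-w , (e , w≡e++DD) , ground)
  with ground-DUU⇒first-return (dyck⇒walk dyck-w) ground
... | u , t , s , p , q , refl
  with DD-suffix (U ∷ u ++ D ∷ t) e (trans (cong (U ∷_) (++-assoc u (D ∷ t) _)) w≡e++DD)
... | e′ , UUs≡e′++DD =
  u , t ++ e′ , p , walk-DD⁻ (t ++ e′) (subst (Walk 0 0) rest q) ,
  cong (λ c → U ∷ u ++ D ∷ c) rest
  where
  rest : t ++ U ∷ U ∷ s ≡ (t ++ e′) ++ D ∷ D ∷ []
  rest = trans (cong (t ++_) UUs≡e′++DD) (sym (++-assoc t e′ _))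

counted⇒fromBallot : Counted n w → ∃[ p ] (Walk 3 0 p × 3 + #U p ≡ n) × fromBallot p ≡ w
counted⇒fromBallot {n} counted@(dyck-w , _) with counted⇒assemble counted
... | u , v , q , r , refl = u ++ D ∷ mirror v , (ballot , count) , shape
  where
  ballot : Walk 3 0 (u ++ D ∷ mirror v)
  ballot = walk-++ (walk-lift (walk-lift (walk-lift q))) (down (walk-mirror r))
  shape : fromBallot (u ++ D ∷ mirror v) ≡ assemble u v
  shape = trans (fromBallot-++ q) (cong (assemble u) (mirror-involutive v))
  count : 3 + #U (u ++ D ∷ mirror v) ≡ n
  count = trans (sym (#U-fromBallot ballot)) (trans (cong #U shape) (DyckPath.ups dyck-w))

fromBallot-walks⇔counted : 3 ≤ n → (w ∈ map fromBallot (walks 3 (n ∸ 3))) ⇔ Counted n w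
fromBallot-walks⇔counted {n} 3≤n = mk⇔ sound complete
  where
  sound : w ∈ map fromBallot (walks 3 (n ∸ 3)) → Counted n w
  sound w∈ with ∈-map⁻ fromBallot w∈
  ... | p , p∈ , refl with ∈-walks⁻ 3 (n ∸ 3) p∈
  ... | ballot , ups =
    subst (λ m → Counted m (fromBallot p)) (trans (cong (3 +_) ups) (m+[n∸m]≡n 3≤n))
          (fromBallot-counted ballot)
  complete : Counted n w → w ∈ map fromBallot (walks 3 (n ∸ 3))
  complete counted with counted⇒fromBallot counted
  ... | p , (ballot , count) , refl =
    ∈-map⁺ fromBallot
           (∈-walks⁺ ballot (trans (sym (m+n∸m≡n 3 (#U p))) (cong (_∸ 3) count)))

lemma13 : (n : ℕ) → 3 ≤ n →
    ∃[ xs ] Unique xs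
          × (∀ (w : List Step) → (w ∈ xs) ⇔ Counted n w)
          × length xs ≡ genCatalan 4 (n ∸ 3)
lemma13 n 3≤n =
  map fromBallot ballots ,
  unique-map-with-retraction {g = toBallot}
    (All.tabulate (toBallot-fromBallot ∘ proj₁ ∘ ∈-walks⁻ 3 (n ∸ 3)))
    (walks-unique 3 (n ∸ 3)) ,
  (λ _ → fromBallot-walks⇔counted 3≤n) ,
  trans (length-map fromBallot ballots) (length-walks 3 (n ∸ 3))
  where
  ballots : List (List Step)
  ballots = walks 3 (n ∸ 3)
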